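{- Let $n\ge 2$ and let $A=[a_{ij}]$ be a real $n\times n$ matrix with $a_{ii}=0$ for all $i$, and let $f(\sigma)=\sum_{k=1}^{n-1}\sum_{l=k+1}^{n} a_{\sigma(k)\sigma(l)}$ be its LOP objective function on $\Sigma_n$. Then $\hat f_{(n-1,1)}=0$ if and only if $$\sum_{j=1}^n (a_{ij}-a_{ji})=0\qquad\text{for all } i=1,\dots,n.$$
   Context: $\Sigma_n$ is the set of permutations of $\{1,\dots,n\}$; $\sigma(k)$ is the row/column index placed in position $k$. Fourier transform over the symmetric group: for a partition $\lambda$ of $n$, with $\rho_\lambda$ an irreducible matrix representation of $\Sigma_n$ indexed by $\lambda$, $\hat f_\lambda=\sum_{\sigma\in\Sigma_n} f(\sigma)\rho_\lambda(\sigma)$. -}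

module Defs where

open import Level using (Level)
open import Algebra.Bundles using (CommutativeRing)
open import Data.Bool using (Bool; true; false; _∧_; _∨_; not; if_then_else_)
open import Data.Nat using (ℕ; zero; suc)
open import Data.Fin using (Fin; zero; suc; inject₁; fromℕ; _≟_; _<?_)
open import Data.List using (List; []; _∷_; [_]; map; concatMap; foldr; filterᵇ; allFin)
open import Relation.Nullary using (¬_; Dec; yes; no; does)
open import Relation.Binary.PropositionalEquality using (_≡_)
open import Data.Product using (∃)

-- The symmetric group Σ_n, enumerated.
-- σ : Fin n → Fin n ; σ k is the row/column index placed in position k.
-- Σ_n is the list of all injective (equivalently bijective, since the set
-- is finite) maps Fin n → Fin n, each occurring exactly once.

consF : ∀ {m n} → Fin n → (Fin m → Fin n) → (Fin (suc m) → Fin n)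
consF i g zero    = i
consF i g (suc k) = g k

allFuns : (m n : ℕ) → List (Fin m → Fin n)
allFuns zero    n = [ (λ ()) ]
allFuns (suc m) n = concatMap (λ i → map (consF i) (allFuns m n)) (allFin n)

allB : ∀ {A : Set} → (A → Bool) → List A → Bool
allB p = foldr (λ x b → p x ∧ b) true

isInjectiveᵇ : ∀ {n} → (Fin n → Fin n) → Bool
isInjectiveᵇ {n} σ =
  allB (λ i → allB (λ j → not (does (σ i ≟ σ j)) ∨ does (i ≟ j)) (allFin n)) (allFin n)

Perms : (n : ℕ) → List (Fin n → Fin n)
Perms n = filterᵇ isInjectiveᵇ (allFuns n n)

module _ {c ℓ : Level} (R : CommutativeRing c ℓ) where
  open CommutativeRing R

  sumL : List Carrier → Carrier
  sumL = foldr _+_ 0#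

  sumFin : ∀ {n} → (Fin n → Carrier) → Carrier
  sumFin {n} g = sumL (map g (allFin n))

  sumPerm : ∀ {n} → ((Fin n → Fin n) → Carrier) → Carrier
  sumPerm {n} g = sumL (map g (Perms n))

  lopObjective : ∀ {n} → (Fin n → Fin n → Carrier) → (Fin n → Fin n) → Carrier
  lopObjective a σ =
    sumFin (λ k → sumFin (λ l → if does (k <? l) then a (σ k) (σ l) else 0#))

  δ : ∀ {n} → Fin n → Fin n → Carrier
  δ i j = if does (i ≟ j) then 1# else 0#

  -- The irreducible representation ρ_{(n-1,1)} of Σ_n, n = suc m (the
  -- standard representation): the permutation action σ·e_j = e_{σ(j)}
  -- restricted to the sum-zero subspace {x ∈ R^n | Σ x_j = 0}, written in the
  -- basis b_i = e_i - e_n (i = 1..n-1).  Since σ·b_i = b_{σ(i)} - b_{σ(n)}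
  -- (with b_n = 0), the (r,i) matrix entry is [σ(i) = r] - [σ(n) = r].
  ρStd : ∀ {m} → (Fin (suc m) → Fin (suc m)) → Fin m → Fin m → Carrier
  ρStd {m} σ r i = δ (σ (inject₁ i)) (inject₁ r) - δ (σ (fromℕ m)) (inject₁ r)

  fourierStd : ∀ {m} → ((Fin (suc m) → Fin (suc m)) → Carrier) → Fin m → Fin m → Carrier
  fourierStd f r i = sumPerm (λ σ → f σ * ρStd σ r i)

  IsZeroMatrix : ∀ {m} → (Fin m → Fin m → Carrier) → Set ℓ
  IsZeroMatrix M = ∀ r i → M r i ≈ 0#

  natToR : ℕ → Carrier
  natToR zero    = 0#
  natToR (suc k) = 1# + natToR k

  record IsCharZeroField : Set (c Level.⊔ ℓ) where
    field
      1≉0     : ¬ (1# ≈ 0#)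
      inverse  : ∀ x → ¬ (x ≈ 0#) → ∃ λ y → x * y ≈ 1#
      charZero : ∀ k → ¬ (natToR (suc k) ≈ 0#)

{-# OPTIONS --safe #-}
module Submission where

-- Let s be the transposition of the neighbouring positions p, p+1. Then f σ - f (σ s) is
-- a(σ p, σ(p+1)) - a(σ(p+1), σ p), the only pair whose order s reverses. Write P(x, q) for the
-- f-weight of the permutations placing x at position q; the entries of the Fourier coefficient
-- are the differences P(x, q) - P(x, n) for x, q < n. Reindexing σ ↦ σ s turns P(x, p) - P(x, p+1)
-- into Σ_y K(x, y) (a_xy - a_yx), where K(x, y) counts the permutations with σ p = x, σ(p+1) = y;
-- post-composing with transpositions shows K(x, y) is one positive integer for all y ≠ x, so
-- P(x, p) - P(x, p+1) = K · Σ_y (a_xy - a_yx). Thus the coefficient vanishes iff these row sums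
-- vanish for x < n, and the sum for x = n follows since all of them add up to zero.

open import Defs
open import Algebra.Bundles using (CommutativeRing)
open import Data.Nat using (ℕ; zero; suc; _≤_; s≤s; s≤s⁻¹)
open import Data.Fin using (Fin; zero; suc; _≟_; _<_; _<?_; toℕ; inject₁; fromℕ)
open import Function.Bundles using (_⇔_; mk⇔; Equivalence)

open import Algebra.Properties.CommutativeSemigroup using (interchange)
open import Data.Bool using (Bool; true; false; _∧_; _∨_; not; if_then_else_)
open import Data.Empty using (⊥-elim)
open import Data.Fin.Permutation.Components using (transpose)
open import Data.Fin.Properties using (all?; ≡-decSetoid; toℕ-inject₁; toℕ-injective; <-trans; <-irrefl; <-asym; <⇒≢; ≤∧≢⇒<)
open import Data.Fin.Relation.Unary.Top using (view; ‵fromℕ; ‵inject₁)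
open import Data.List using (List; []; _∷_; map; concatMap; filterᵇ; allFin; tabulate; length; _++_)
open import Data.List.Membership.Propositional using (_∈_)
open import Data.List.Membership.Propositional.Properties using (∈-allFin; ∈-map⁺; ∈-concat⁺′)
open import Data.List.Properties using (map-tabulate; map-cong)
open import Data.List.Relation.Unary.Any using (here; there)
import Data.Nat.Properties as ℕ
open import Data.Product using (∃; _×_; _,_; proj₁; proj₂)
open import Function using (_∘_; id)
open import Function.Properties.Equivalence using () renaming (refl to ⇔-refl; sym to ⇔-sym)
open import Level using (0ℓ)
open import Relation.Binary.Bundles using (Setoid; DecSetoid)
open import Relation.Binary.Core using (_Preserves_⟶_)
open import Relation.Binary.Definitions using (Decidable)
open import Relation.Binary.PropositionalEquality as ≡ using (_≡_; _≢_; _≗_; _→-setoid_)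
open import Relation.Nullary using (Dec; yes; no; does; ¬_; _×-dec_; _→-dec_)
open import Relation.Nullary.Decidable using (dec-true; dec-false; does-⇔)
open import Relation.Unary using () renaming (Decidable to Decidable₁)

infix 4 _≗?_
_≗?_ : ∀ {m n} → Decidable (_≗_ {A = Fin m} {B = Fin n})
h ≗? w = all? (λ k → h k ≟ w k)

≗-decSetoid : ℕ → ℕ → DecSetoid 0ℓ 0ℓ
≗-decSetoid m n = record
  { isDecEquivalence = record
    { isEquivalence = Setoid.isEquivalence (Fin m →-setoid Fin n)
    ; _≟_           = _≗?_
    }
  }

consF-≗ : ∀ {m n} (i : Fin n) (t : Fin m → Fin n) (w : Fin (suc m) → Fin n) →
          consF i t ≗ w ⇔ (i ≡ w zero × t ≗ w ∘ suc)
consF-≗ i t w = mk⇔ (λ e → e zero , e ∘ suc) λ { (e₀ , e) → λ { zero → e₀ ; (suc k) → e k } }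

allB-tabulate : ∀ {n p} {A : Set} {P : Fin n → Set p} (b : A → Bool) (f : Fin n → A) (P? : Decidable₁ P) →
                (∀ i → b (f i) ≡ does (P? i)) → allB b (tabulate f) ≡ does (all? P?)
allB-tabulate {zero}  b f P? b≡P? = ≡.refl
allB-tabulate {suc n} b f P? b≡P? = ≡.cong₂ _∧_ (b≡P? zero) (allB-tabulate b (f ∘ suc) (P? ∘ suc) (b≡P? ∘ suc))

IsInjective : ∀ {n} → (Fin n → Fin n) → Set
IsInjective σ = ∀ i j → σ i ≡ σ j → i ≡ j

IsInjective-≗ : ∀ {n} {σ τ : Fin n → Fin n} → σ ≗ τ → IsInjective σ → IsInjective τ
IsInjective-≗ σ≗τ σ-inj i j τi≡τj = σ-inj i j (≡.trans (σ≗τ i) (≡.trans τi≡τj (≡.sym (σ≗τ j))))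

injective? : ∀ {n} (σ : Fin n → Fin n) → Dec (IsInjective σ)
injective? σ = all? λ i → all? λ j → (σ i ≟ σ j) →-dec (i ≟ j)

isInjectiveᵇ≡does-injective? : ∀ {n} (σ : Fin n → Fin n) → isInjectiveᵇ σ ≡ does (injective? σ)
isInjectiveᵇ≡does-injective? σ =
  allB-tabulate _ id _ λ i → allB-tabulate (λ j → not (does (σ i ≟ σ j)) ∨ does (i ≟ j)) id _ λ j → ≡.refl

isInjectiveᵇ-cong : ∀ {n} {σ τ : Fin n → Fin n} → IsInjective σ ⇔ IsInjective τ → isInjectiveᵇ σ ≡ isInjectiveᵇ τ
isInjectiveᵇ-cong {σ = σ} {τ} inj⇔ = begin
  isInjectiveᵇ σ        ≡⟨ isInjectiveᵇ≡does-injective? σ ⟩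
  does (injective? σ)   ≡⟨ does-⇔ inj⇔ (injective? σ) (injective? τ) ⟩
  does (injective? τ)   ≡⟨ isInjectiveᵇ≡does-injective? τ ⟨
  isInjectiveᵇ τ        ∎
  where open ≡.≡-Reasoning

isInjectiveᵇ-≗ : ∀ {n} {σ τ : Fin n → Fin n} → σ ≗ τ → isInjectiveᵇ σ ≡ isInjectiveᵇ τ
isInjectiveᵇ-≗ σ≗τ = isInjectiveᵇ-cong (mk⇔ (IsInjective-≗ σ≗τ) (IsInjective-≗ (≡.sym ∘ σ≗τ)))

allFuns-complete : ∀ m n (w : Fin m → Fin n) → ∃ λ h → h ∈ allFuns m n × h ≗ w
allFuns-complete zero    n w = (λ ()) , here ≡.refl , (λ ())
allFuns-complete (suc m) n w with allFuns-complete m n (w ∘ suc)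
... | t , t∈ , t≗ = consF (w zero) t
                  , ∈-concat⁺′ (∈-map⁺ (consF (w zero)) t∈) (∈-map⁺ (λ i → map (consF i) (allFuns m n)) (∈-allFin (w zero)))
                  , Equivalence.from (consF-≗ (w zero) t w) (≡.refl , t≗)

length-filterᵇ-∈ : ∀ {A : Set} (p : A → Bool) {l : List A} {x} → x ∈ l → p x ≡ true → ∃ λ k → length (filterᵇ p l) ≡ suc k
length-filterᵇ-∈ p {y ∷ l} (here ≡.refl) px≡true rewrite px≡true = length (filterᵇ p l) , ≡.refl
length-filterᵇ-∈ p {y ∷ l} (there x∈l) px≡true with p y | length-filterᵇ-∈ p x∈l px≡true
... | true  | _   = length (filterᵇ p l) , ≡.refl
... | false | pos = pos

module _ {n} (i j : Fin n) where

  transpose-matchˡ : transpose i j i ≡ j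
  transpose-matchˡ rewrite dec-true (i ≟ i) ≡.refl = ≡.refl

  transpose-matchʳ : transpose i j j ≡ i
  transpose-matchʳ with i ≟ j
  ... | yes ≡.refl = transpose-matchˡ
  ... | no i≢j rewrite dec-false (j ≟ i) (i≢j ∘ ≡.sym) | dec-true (j ≟ j) ≡.refl = ≡.refl

  transpose-mismatch : ∀ {k} → k ≢ i → k ≢ j → transpose i j k ≡ k
  transpose-mismatch {k} k≢i k≢j rewrite dec-false (k ≟ i) k≢i | dec-false (k ≟ j) k≢j = ≡.refl

  transpose-involutive : ∀ k → transpose i j (transpose i j k) ≡ k
  transpose-involutive k = by-cases (k ≟ i) (k ≟ j)
    where
    by-cases : Dec (k ≡ i) → Dec (k ≡ j) → transpose i j (transpose i j k) ≡ k
    by-cases (yes ≡.refl) _ = ≡.trans (≡.cong (transpose i j) transpose-matchˡ) transpose-matchʳ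
    by-cases (no _) (yes ≡.refl) = ≡.trans (≡.cong (transpose i j) transpose-matchʳ) transpose-matchˡ
    by-cases (no k≢i) (no k≢j) = ≡.trans (≡.cong (transpose i j) (transpose-mismatch k≢i k≢j)) (transpose-mismatch k≢i k≢j)

  transpose-≡⇔ : ∀ {u v} → transpose i j u ≡ v ⇔ u ≡ transpose i j v
  transpose-≡⇔ {u} {v} = mk⇔ (λ e → ≡.trans (≡.sym (transpose-involutive u)) (≡.cong (transpose i j) e))
                             (λ e → ≡.trans (≡.cong (transpose i j) e) (transpose-involutive v))

  transpose-injective : IsInjective (transpose i j)
  transpose-injective k l e = ≡.trans (≡.sym (transpose-involutive k)) (≡.trans (≡.cong (transpose i j) e) (transpose-involutive l))

∃-≢ : ∀ {n} {q q′ : Fin n} → q ≢ q′ → ∀ x → ∃ λ y → y ≢ x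
∃-≢ {q = q} {q′} q≢q′ x with x ≟ q
... | yes x≡q = q′ , λ q′≡x → q≢q′ (≡.sym (≡.trans q′≡x x≡q))
... | no  x≢q = q  , x≢q ∘ ≡.sym

2-transitive : ∀ {n} {q q′ x y : Fin n} → q ≢ q′ → x ≢ y → ∃ λ w → IsInjective w × w q ≡ x × w q′ ≡ y
2-transitive {q = q} {q′} {x} {y} q≢q′ x≢y =
  transpose z y ∘ transpose q x
  , (λ k l → transpose-injective q x k l ∘ transpose-injective z y _ _)
  , ≡.trans (≡.cong (transpose z y) (transpose-matchˡ q x)) (transpose-mismatch z y x≢z x≢y)
  , transpose-matchˡ z y
  where
  z = transpose q x q′
  x≢z : x ≢ z
  x≢z x≡z = q≢q′ (transpose-injective q x q q′ (≡.trans (transpose-matchˡ q x) x≡z))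

inject₁<suc : ∀ {m} (j : Fin m) → inject₁ j < suc j
inject₁<suc j = ℕ.≤-reflexive (≡.cong suc (toℕ-inject₁ j))

adjacentTransposition : ∀ {m} → Fin m → Fin (suc m) → Fin (suc m)
adjacentTransposition j = transpose (inject₁ j) (suc j)

module _ {m} (j : Fin m) where
  private
    p p′ : Fin (suc m)
    p  = inject₁ j
    p′ = suc j

    p<p′ : p < p′
    p<p′ = inject₁<suc j

    p<x⇔p′<x : ∀ {x} → x ≢ p′ → p < x ⇔ p′ < x
    p<x⇔p′<x {x} x≢p′ = mk⇔
      (λ p<x → ℕ.≤∧≢⇒< (≡.subst (_≤ toℕ x) (≡.cong suc (toℕ-inject₁ j)) p<x) (x≢p′ ∘ ≡.sym ∘ toℕ-injective))
      (<-trans p<p′)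

    x<p⇔x<p′ : ∀ {x} → x ≢ p → x < p ⇔ x < p′
    x<p⇔x<p′ {x} x≢p = mk⇔
      (λ x<p → <-trans x<p p<p′)
      (λ x<p′ → ≤∧≢⇒< (≡.subst (toℕ x ≤_) (≡.sym (toℕ-inject₁ j)) (s≤s⁻¹ x<p′)) x≢p)

    data Around (k : Fin (suc m)) : Set where
      at-p   : k ≡ p → Around k
      at-p′  : k ≡ p′ → Around k
      apart  : k ≢ p → k ≢ p′ → Around k

    around : ∀ k → Around k
    around k with k ≟ p | k ≟ p′
    ... | yes k≡p | _        = at-p k≡p
    ... | no _    | yes k≡p′ = at-p′ k≡p′
    ... | no k≢p  | no k≢p′  = apart k≢p k≢p′

    irrefl⇔ : ∀ {k l : Fin (suc m)} → k < k ⇔ l < l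
    irrefl⇔ = mk⇔ (⊥-elim ∘ <-irrefl ≡.refl) (⊥-elim ∘ <-irrefl ≡.refl)

  adjacentTransposition-<⇔ : ∀ {k l} → ¬ (k ≡ p × l ≡ p′) → ¬ (k ≡ p′ × l ≡ p) →
                             k < l ⇔ adjacentTransposition j k < adjacentTransposition j l
  adjacentTransposition-<⇔ {k} {l} ¬pp′ ¬p′p with around k | around l
  ... | at-p ≡.refl  | at-p ≡.refl  = irrefl⇔
  ... | at-p′ ≡.refl | at-p′ ≡.refl = irrefl⇔
  ... | at-p ≡.refl  | at-p′ ≡.refl = ⊥-elim (¬pp′ (≡.refl , ≡.refl))
  ... | at-p′ ≡.refl | at-p ≡.refl  = ⊥-elim (¬p′p (≡.refl , ≡.refl))
  ... | at-p ≡.refl  | apart l≢p l≢p′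
    rewrite transpose-matchˡ p p′ | transpose-mismatch p p′ l≢p l≢p′ = p<x⇔p′<x l≢p′
  ... | at-p′ ≡.refl | apart l≢p l≢p′
    rewrite transpose-matchʳ p p′ | transpose-mismatch p p′ l≢p l≢p′ = ⇔-sym (p<x⇔p′<x l≢p′)
  ... | apart k≢p k≢p′ | at-p ≡.refl
    rewrite transpose-matchˡ p p′ | transpose-mismatch p p′ k≢p k≢p′ = x<p⇔x<p′ k≢p
  ... | apart k≢p k≢p′ | at-p′ ≡.refl
    rewrite transpose-matchʳ p p′ | transpose-mismatch p p′ k≢p k≢p′ = ⇔-sym (x<p⇔x<p′ k≢p)
  ... | apart k≢p k≢p′ | apart l≢p l≢p′
    rewrite transpose-mismatch p p′ k≢p k≢p′ | transpose-mismatch p p′ l≢p l≢p′ = ⇔-refl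

module Sums {c ℓ} (R : CommutativeRing c ℓ) where
  open CommutativeRing R hiding (zero)
  open import Algebra.Properties.Ring ring using (-‿+-comm; -0#≈0#)
  open import Relation.Binary.Reasoning.Setoid setoid

  sumOver : ∀ {a} {A : Set a} → List A → (A → Carrier) → Carrier
  sumOver l g = sumL R (map g l)

  syntax sumOver l (λ x → e) = ∑[ x ∈ l ] e

  module _ {a} {A : Set a} where

    ∑-cong : (l : List A) {g h : A → Carrier} → (∀ x → g x ≈ h x) → ∑[ x ∈ l ] g x ≈ ∑[ x ∈ l ] h x
    ∑-cong []      g≈h = refl
    ∑-cong (x ∷ l) g≈h = +-cong (g≈h x) (∑-cong l g≈h)

    ∑-zero : (l : List A) → ∑[ x ∈ l ] 0# ≈ 0#
    ∑-zero []      = refl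
    ∑-zero (x ∷ l) = trans (+-identityˡ _) (∑-zero l)

    ∑-distrib-+ : (l : List A) (g h : A → Carrier) → ∑[ x ∈ l ] (g x + h x) ≈ ∑[ x ∈ l ] g x + ∑[ x ∈ l ] h x
    ∑-distrib-+ []      g h = sym (+-identityˡ 0#)
    ∑-distrib-+ (x ∷ l) g h = trans (+-congˡ (∑-distrib-+ l g h)) (interchange +-commutativeSemigroup _ _ _ _)

    ∑-distrib-neg : (l : List A) (g : A → Carrier) → ∑[ x ∈ l ] (- g x) ≈ - ∑[ x ∈ l ] g x
    ∑-distrib-neg []      g = sym -0#≈0#
    ∑-distrib-neg (x ∷ l) g = trans (+-congˡ (∑-distrib-neg l g)) (-‿+-comm (g x) _)

    ∑-distrib-sub : (l : List A) (g h : A → Carrier) → ∑[ x ∈ l ] (g x - h x) ≈ ∑[ x ∈ l ] g x - ∑[ x ∈ l ] h x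
    ∑-distrib-sub l g h = trans (∑-distrib-+ l g (λ x → - h x)) (+-congˡ (∑-distrib-neg l h))

    *-distribˡ-∑ : (l : List A) (k : Carrier) (g : A → Carrier) → k * ∑[ x ∈ l ] g x ≈ ∑[ x ∈ l ] (k * g x)
    *-distribˡ-∑ []      k g = zeroʳ k
    *-distribˡ-∑ (x ∷ l) k g = trans (distribˡ k (g x) _) (+-congˡ (*-distribˡ-∑ l k g))

    *-distribʳ-∑ : (l : List A) (k : Carrier) (g : A → Carrier) → ∑[ x ∈ l ] g x * k ≈ ∑[ x ∈ l ] (g x * k)
    *-distribʳ-∑ l k g = trans (*-comm _ k) (trans (*-distribˡ-∑ l k g) (∑-cong l (λ x → *-comm k (g x))))

    ∑-++ : (l₁ l₂ : List A) (g : A → Carrier) → ∑[ x ∈ l₁ ++ l₂ ] g x ≈ ∑[ x ∈ l₁ ] g x + ∑[ x ∈ l₂ ] g x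
    ∑-++ []       l₂ g = sym (+-identityˡ _)
    ∑-++ (x ∷ l₁) l₂ g = trans (+-congˡ (∑-++ l₁ l₂ g)) (sym (+-assoc _ _ _))

    ∑-filterᵇ : (p : A → Bool) (l : List A) (g : A → Carrier) →
                ∑[ x ∈ filterᵇ p l ] g x ≈ ∑[ x ∈ l ] (if p x then g x else 0#)
    ∑-filterᵇ p []      g = refl
    ∑-filterᵇ p (x ∷ l) g with p x
    ... | true  = +-congˡ (∑-filterᵇ p l g)
    ... | false = trans (∑-filterᵇ p l g) (sym (+-identityˡ _))

  module _ {a b} {A : Set a} {B : Set b} where

    ∑-comm : (l₁ : List A) (l₂ : List B) (g : A → B → Carrier) →
             ∑[ x ∈ l₁ ] ∑[ y ∈ l₂ ] g x y ≈ ∑[ y ∈ l₂ ] ∑[ x ∈ l₁ ] g x y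
    ∑-comm []       l₂ g = sym (∑-zero l₂)
    ∑-comm (x ∷ l₁) l₂ g = trans (+-congˡ (∑-comm l₁ l₂ g)) (sym (∑-distrib-+ l₂ (g x) _))

    ∑-map : (l : List A) (k : A → B) (g : B → Carrier) → ∑[ y ∈ map k l ] g y ≈ ∑[ x ∈ l ] g (k x)
    ∑-map []      k g = refl
    ∑-map (x ∷ l) k g = +-congˡ (∑-map l k g)

    ∑-concatMap : (l : List A) (k : A → List B) (g : B → Carrier) →
                  ∑[ y ∈ concatMap k l ] g y ≈ ∑[ x ∈ l ] ∑[ y ∈ k x ] g y
    ∑-concatMap []      k g = refl
    ∑-concatMap (x ∷ l) k g = trans (∑-++ (k x) (concatMap k l) g) (+-congˡ (∑-concatMap l k g))

  ∑∑-distrib-sub : ∀ {a b} {A : Set a} {B : Set b} (l₁ : List A) (l₂ : List B) (g h : A → B → Carrier) →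
                   ∑[ x ∈ l₁ ] ∑[ y ∈ l₂ ] (g x y - h x y) ≈ ∑[ x ∈ l₁ ] ∑[ y ∈ l₂ ] g x y - ∑[ x ∈ l₁ ] ∑[ y ∈ l₂ ] h x y
  ∑∑-distrib-sub l₁ l₂ g h = trans (∑-cong l₁ (λ x → ∑-distrib-sub l₂ (g x) (h x))) (∑-distrib-sub l₁ _ _)

  ∑∑-antisymmetric : ∀ {a} {A : Set a} (l : List A) (g : A → A → Carrier) → ∑[ x ∈ l ] ∑[ y ∈ l ] (g x y - g y x) ≈ 0#
  ∑∑-antisymmetric l g = begin
    ∑[ x ∈ l ] ∑[ y ∈ l ] (g x y - g y x)                        ≈⟨ ∑∑-distrib-sub l l _ _ ⟩
    ∑[ x ∈ l ] ∑[ y ∈ l ] g x y - ∑[ x ∈ l ] ∑[ y ∈ l ] g y x    ≈⟨ +-congˡ (-‿cong (∑-comm l l (λ x y → g y x))) ⟩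
    ∑[ x ∈ l ] ∑[ y ∈ l ] g x y - ∑[ y ∈ l ] ∑[ x ∈ l ] g y x    ≈⟨ -‿inverseʳ _ ⟩
    0#                                                           ∎

  ∑-allFin-suc : ∀ {n} (g : Fin (suc n) → Carrier) → ∑[ i ∈ allFin (suc n) ] g i ≈ g zero + ∑[ i ∈ allFin n ] g (suc i)
  ∑-allFin-suc {n} g = +-congˡ (reflexive (≡.cong (sumL R) (≡.trans (map-tabulate suc g) (≡.sym (map-tabulate id (g ∘ suc))))))

  ∑-count : ∀ {a} {A : Set a} (p : A → Bool) (l : List A) → ∑[ x ∈ l ] (if p x then 1# else 0#) ≈ natToR R (length (filterᵇ p l))
  ∑-count p []      = refl
  ∑-count p (x ∷ l) with p x
  ... | true  = +-congˡ (∑-count p l)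
  ... | false = trans (+-identityˡ _) (∑-count p l)

  𝟙 : ∀ {p} {P : Set p} → Dec P → Carrier
  𝟙 P? = if does P? then 1# else 0#

  module _ {p} {P : Set p} where

    𝟙-yes : (P? : Dec P) → P → 𝟙 P? ≡ 1#
    𝟙-yes P? x rewrite dec-true P? x = ≡.refl

    𝟙-no : (P? : Dec P) → ¬ P → 𝟙 P? ≡ 0#
    𝟙-no P? ¬x rewrite dec-false P? ¬x = ≡.refl

    𝟙-* : ∀ {q} {Q : Set q} (P? : Dec P) (Q? : Dec Q) → 𝟙 (P? ×-dec Q?) ≈ 𝟙 P? * 𝟙 Q?
    𝟙-* P? Q? with does P?
    ... | true  = sym (*-identityˡ _)
    ... | false = sym (zeroˡ _)

    𝟙-cong : ∀ {q} {Q : Set q} → P ⇔ Q → (P? : Dec P) (Q? : Dec Q) → 𝟙 P? ≡ 𝟙 Q?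
    𝟙-cong P⇔Q P? Q? = ≡.cong (if_then 1# else 0#) (does-⇔ P⇔Q P? Q?)

  select≈𝟙* : ∀ {p} {P : Set p} (P? : Dec P) x → (if does P? then x else 0#) ≈ 𝟙 P? * x
  select≈𝟙* P? x with does P?
  ... | true  = sym (*-identityˡ x)
  ... | false = sym (zeroˡ x)

  module _ {a ℓ′} (D : DecSetoid a ℓ′) where
    open DecSetoid D using () renaming (Carrier to A; _≈_ to _∼_; _≟_ to _∼?_; sym to ∼-sym; trans to ∼-trans)

    -- L lists every element of D exactly once up to ∼, expressed as the sifting property of the
    -- Kronecker delta.
    Sifting : List A → Set _
    Sifting L = ∀ w (G : A → Carrier) → G Preserves _∼_ ⟶ _≈_ → ∑[ h ∈ L ] (𝟙 (h ∼? w) * G h) ≈ G w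

    module _ {L : List A} (sift : Sifting L) where

      ∑-𝟙 : ∀ w → ∑[ h ∈ L ] 𝟙 (h ∼? w) ≈ 1#
      ∑-𝟙 w = trans (∑-cong L (λ h → sym (*-identityʳ _))) (sift w (λ _ → 1#) (λ _ → refl))

      ∑-concentrated : ∀ w (G : A → Carrier) → G Preserves _∼_ ⟶ _≈_ → (∀ h → ¬ h ∼ w → G h ≈ 0#) → ∑[ h ∈ L ] G h ≈ G w
      ∑-concentrated w G G-cong G-vanishes = trans (∑-cong L select) (sift w G G-cong)
        where
        select : ∀ h → G h ≈ 𝟙 (h ∼? w) * G h
        select h with h ∼? w
        ... | yes _   = sym (*-identityˡ _)
        ... | no h≁w = trans (G-vanishes h h≁w) (sym (zeroˡ _))

      ∑-involution : (Φ : A → A) → Φ Preserves _∼_ ⟶ _∼_ → (∀ h → Φ (Φ h) ∼ h) →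
                     (G : A → Carrier) → G Preserves _∼_ ⟶ _≈_ → ∑[ h ∈ L ] G (Φ h) ≈ ∑[ h ∈ L ] G h
      ∑-involution Φ Φ-cong Φ-inv G G-cong = begin
        ∑[ h ∈ L ] G (Φ h)                          ≈⟨ ∑-cong L (λ h → sift (Φ h) G G-cong) ⟨
        ∑[ h ∈ L ] ∑[ w ∈ L ] (𝟙 (w ∼? Φ h) * G w)  ≈⟨ ∑-comm L L _ ⟩
        ∑[ w ∈ L ] ∑[ h ∈ L ] (𝟙 (w ∼? Φ h) * G w)  ≈⟨ ∑-cong L (λ w → ∑-cong L (λ h → *-congʳ (reflexive (swap w h)))) ⟩
        ∑[ w ∈ L ] ∑[ h ∈ L ] (𝟙 (h ∼? Φ w) * G w)  ≈⟨ ∑-cong L (λ w → *-distribʳ-∑ L (G w) _) ⟨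
        ∑[ w ∈ L ] (∑[ h ∈ L ] 𝟙 (h ∼? Φ w) * G w)  ≈⟨ ∑-cong L (λ w → trans (*-congʳ (∑-𝟙 (Φ w))) (*-identityˡ _)) ⟩
        ∑[ w ∈ L ] G w                              ∎
        where
        flip : ∀ w h → w ∼ Φ h → h ∼ Φ w
        flip w h w∼Φh = ∼-sym (∼-trans (Φ-cong w∼Φh) (Φ-inv h))
        swap : ∀ w h → 𝟙 (w ∼? Φ h) ≡ 𝟙 (h ∼? Φ w)
        swap w h = 𝟙-cong (mk⇔ (flip w h) (flip h w)) (w ∼? Φ h) (h ∼? Φ w)

  allFin-sifting : ∀ {n} → Sifting (≡-decSetoid n) (allFin n)
  allFin-sifting {suc n} zero G _ = begin
    ∑[ i ∈ allFin (suc n) ] (𝟙 (i ≟ zero) * G i)       ≈⟨ ∑-allFin-suc (λ i → 𝟙 (i ≟ zero) * G i) ⟩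
    1# * G zero + ∑[ i ∈ allFin n ] (0# * G (suc i))   ≈⟨ +-congʳ (*-identityˡ _) ⟩
    G zero + ∑[ i ∈ allFin n ] (0# * G (suc i))        ≈⟨ +-congˡ (trans (∑-cong (allFin n) (λ _ → zeroˡ _)) (∑-zero (allFin n))) ⟩
    G zero + 0#                                        ≈⟨ +-identityʳ _ ⟩
    G zero                                             ∎
  allFin-sifting {suc n} (suc w) G _ = begin
    ∑[ i ∈ allFin (suc n) ] (𝟙 (i ≟ suc w) * G i)                  ≈⟨ ∑-allFin-suc (λ i → 𝟙 (i ≟ suc w) * G i) ⟩
    0# * G zero + ∑[ i ∈ allFin n ] (𝟙 (i ≟ w) * G (suc i))
      ≈⟨ +-cong (zeroˡ _) (allFin-sifting w (G ∘ suc) (reflexive ∘ ≡.cong (G ∘ suc))) ⟩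
    0# + G (suc w)                                                 ≈⟨ +-identityˡ _ ⟩
    G (suc w)                                                      ∎

  allFuns-sifting : ∀ {m n} → Sifting (≗-decSetoid m n) (allFuns m n)
  allFuns-sifting {zero} w G G-cong =
    trans (+-identityʳ _) (trans (*-congʳ (reflexive (𝟙-yes ((λ ()) ≗? w) λ ()))) (trans (*-identityˡ _) (G-cong λ ())))
  allFuns-sifting {suc m} {n} w G G-cong = begin
    ∑[ h ∈ allFuns (suc m) n ] (𝟙 (h ≗? w) * G h)
      ≈⟨ ∑-concatMap (allFin n) (λ i → map (consF i) (allFuns m n)) _ ⟩
    ∑[ i ∈ allFin n ] ∑[ h ∈ map (consF i) (allFuns m n) ] (𝟙 (h ≗? w) * G h)
      ≈⟨ ∑-cong (allFin n) (λ i → ∑-map (allFuns m n) (consF i) _) ⟩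
    ∑[ i ∈ allFin n ] ∑[ t ∈ allFuns m n ] (𝟙 (consF i t ≗? w) * G (consF i t))
      ≈⟨ ∑-cong (allFin n) (λ i → ∑-cong (allFuns m n) (λ t → split i t)) ⟩
    ∑[ i ∈ allFin n ] ∑[ t ∈ allFuns m n ] (𝟙 (i ≟ w zero) * (𝟙 (t ≗? (w ∘ suc)) * G (consF i t)))
      ≈⟨ ∑-cong (allFin n) (λ i → *-distribˡ-∑ (allFuns m n) _ _) ⟨
    ∑[ i ∈ allFin n ] (𝟙 (i ≟ w zero) * ∑[ t ∈ allFuns m n ] (𝟙 (t ≗? (w ∘ suc)) * G (consF i t)))
      ≈⟨ ∑-cong (allFin n) (λ i → *-congˡ (allFuns-sifting (w ∘ suc) (G ∘ consF i) (λ e → G-cong (consF-cong i e)))) ⟩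
    ∑[ i ∈ allFin n ] (𝟙 (i ≟ w zero) * G (consF i (w ∘ suc)))
      ≈⟨ allFin-sifting (w zero) _ (reflexive ∘ ≡.cong (λ i → G (consF i (w ∘ suc)))) ⟩
    G (consF (w zero) (w ∘ suc))
      ≈⟨ G-cong (Equivalence.from (consF-≗ (w zero) (w ∘ suc) w) (≡.refl , λ _ → ≡.refl)) ⟩
    G w ∎
    where
    consF-cong : ∀ i {t t′ : Fin m → Fin n} → t ≗ t′ → consF i t ≗ consF i t′
    consF-cong i e zero    = ≡.refl
    consF-cong i e (suc k) = e k
    split : ∀ i t → 𝟙 (consF i t ≗? w) * G (consF i t) ≈ 𝟙 (i ≟ w zero) * (𝟙 (t ≗? (w ∘ suc)) * G (consF i t))
    split i t = begin
      𝟙 (consF i t ≗? w) * G (consF i t)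
        ≡⟨ ≡.cong (_* _) (𝟙-cong (consF-≗ i t w) (consF i t ≗? w) ((i ≟ w zero) ×-dec (t ≗? (w ∘ suc)))) ⟩
      𝟙 ((i ≟ w zero) ×-dec (t ≗? (w ∘ suc))) * G (consF i t)           ≈⟨ *-congʳ (𝟙-* (i ≟ w zero) (t ≗? (w ∘ suc))) ⟩
      𝟙 (i ≟ w zero) * 𝟙 (t ≗? (w ∘ suc)) * G (consF i t)               ≈⟨ *-assoc _ _ _ ⟩
      𝟙 (i ≟ w zero) * (𝟙 (t ≗? (w ∘ suc)) * G (consF i t))             ∎

  ∑∑-allFin-transpose : ∀ {n} (i j : Fin n) (g : Fin n → Fin n → Carrier) →
                        ∑[ k ∈ allFin n ] ∑[ l ∈ allFin n ] g (transpose i j k) (transpose i j l) ≈ ∑[ k ∈ allFin n ] ∑[ l ∈ allFin n ] g k l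
  ∑∑-allFin-transpose {n} i j g =
    trans (∑-cong (allFin n) (λ k → ∑-transpose (g (transpose i j k)))) (∑-transpose (λ k → ∑[ l ∈ allFin n ] g k l))
    where
    ∑-transpose : (h : Fin n → Carrier) → ∑[ k ∈ allFin n ] h (transpose i j k) ≈ ∑[ k ∈ allFin n ] h k
    ∑-transpose h = ∑-involution (≡-decSetoid n) {allFin n} allFin-sifting (transpose i j) (≡.cong (transpose i j))
                                 (transpose-involutive i j) h (reflexive ∘ ≡.cong h)

  ∑∑-allFin-sifting : ∀ {n} (x y : Fin n) (A : Fin n → Fin n → Carrier) →
                      ∑[ k ∈ allFin n ] ∑[ l ∈ allFin n ] (𝟙 ((k ≟ x) ×-dec (l ≟ y)) * A k l) ≈ A x y
  ∑∑-allFin-sifting {n} x y A = begin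
    ∑[ k ∈ allFin n ] ∑[ l ∈ allFin n ] (𝟙 ((k ≟ x) ×-dec (l ≟ y)) * A k l)
      ≈⟨ ∑-cong (allFin n) (λ k → ∑-cong (allFin n) (λ l → trans (*-congʳ (𝟙-* (k ≟ x) (l ≟ y))) (*-assoc _ _ _))) ⟩
    ∑[ k ∈ allFin n ] ∑[ l ∈ allFin n ] (𝟙 (k ≟ x) * (𝟙 (l ≟ y) * A k l))
      ≈⟨ ∑-cong (allFin n) (λ k → *-distribˡ-∑ (allFin n) (𝟙 (k ≟ x)) _) ⟨
    ∑[ k ∈ allFin n ] (𝟙 (k ≟ x) * ∑[ l ∈ allFin n ] (𝟙 (l ≟ y) * A k l))
      ≈⟨ ∑-cong (allFin n) (λ k → *-congˡ (allFin-sifting y (A k) (reflexive ∘ ≡.cong (A k)))) ⟩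
    ∑[ k ∈ allFin n ] (𝟙 (k ≟ x) * A k y)
      ≈⟨ allFin-sifting x (λ k → A k y) (reflexive ∘ ≡.cong (λ k → A k y)) ⟩
    A x y ∎

  sumPerm-involution : ∀ {n} (Φ : (Fin n → Fin n) → (Fin n → Fin n)) → Φ Preserves _≗_ ⟶ _≗_ →
                       (∀ σ → Φ (Φ σ) ≗ σ) → (∀ σ → IsInjective σ → IsInjective (Φ σ)) →
                       (g : (Fin n → Fin n) → Carrier) → g Preserves _≗_ ⟶ _≈_ → sumPerm R (g ∘ Φ) ≈ sumPerm R g
  sumPerm-involution {n} Φ Φ-cong Φ-inv Φ-inj g g-cong = begin
    sumPerm R (g ∘ Φ)                                          ≈⟨ ∑-filterᵇ isInjectiveᵇ L (g ∘ Φ) ⟩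
    ∑[ σ ∈ L ] (if isInjectiveᵇ σ then g (Φ σ) else 0#)
      ≡⟨ ≡.cong (sumL R) (map-cong (λ σ → ≡.cong (if_then g (Φ σ) else 0#) (Φ-isInjectiveᵇ σ)) L) ⟩
    ∑[ σ ∈ L ] G (Φ σ)                                         ≈⟨ ∑-involution (≗-decSetoid n n) {L} allFuns-sifting Φ Φ-cong Φ-inv G G-cong ⟩
    ∑[ σ ∈ L ] G σ                                             ≈⟨ ∑-filterᵇ isInjectiveᵇ L g ⟨
    sumPerm R g                                                ∎
    where
    L = allFuns n n
    G : (Fin n → Fin n) → Carrier
    G σ = if isInjectiveᵇ σ then g σ else 0#
    G-cong : G Preserves _≗_ ⟶ _≈_
    G-cong {σ} {τ} σ≗τ rewrite isInjectiveᵇ-≗ σ≗τ with isInjectiveᵇ τ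
    ... | true  = g-cong σ≗τ
    ... | false = refl
    Φ-isInjectiveᵇ : ∀ σ → isInjectiveᵇ σ ≡ isInjectiveᵇ (Φ σ)
    Φ-isInjectiveᵇ σ = isInjectiveᵇ-cong (mk⇔ (Φ-inj σ) (IsInjective-≗ (Φ-inv σ) ∘ Φ-inj (Φ σ)))

module LinearOrdering {c ℓ} (R : CommutativeRing c ℓ) where
  open CommutativeRing R hiding (zero)
  open Sums R
  open import Algebra.Properties.Ring ring using ([y-z]x≈yx-zx; x[y-z]≈xy-xz; x∙y⁻¹≈ε⇒x≈y)
  open import Relation.Binary.Reasoning.Setoid setoid

  adjacent≈⇒≈fromℕ : ∀ {m} (H : Fin (suc m) → Carrier) → (∀ j → H (inject₁ j) ≈ H (suc j)) → ∀ q → H q ≈ H (fromℕ m)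
  adjacent≈⇒≈fromℕ {zero}  H adj zero    = refl
  adjacent≈⇒≈fromℕ {suc m} H adj zero    = trans (adj zero) (adjacent≈⇒≈fromℕ (H ∘ suc) (adj ∘ suc) zero)
  adjacent≈⇒≈fromℕ {suc m} H adj (suc q) = adjacent≈⇒≈fromℕ (H ∘ suc) (adj ∘ suc) q

  module _ {m} (j : Fin m) where
    private
      p p′ : Fin (suc m)
      p  = inject₁ j
      p′ = suc j
      s  = adjacentTransposition j
      s-involutive = transpose-involutive p p′

    𝟙-<-adjacentTransposition : ∀ k l →
      𝟙 (k <? l) - 𝟙 (s k <? s l) ≈ 𝟙 ((k ≟ p) ×-dec (l ≟ p′)) - 𝟙 ((k ≟ p′) ×-dec (l ≟ p))
    𝟙-<-adjacentTransposition k l = by-cases ((k ≟ p) ×-dec (l ≟ p′)) ((k ≟ p′) ×-dec (l ≟ p))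
      where
      p≢p′ : p ≢ p′
      p≢p′ = <⇒≢ (inject₁<suc j)
      by-cases : Dec (k ≡ p × l ≡ p′) → Dec (k ≡ p′ × l ≡ p) →
                 𝟙 (k <? l) - 𝟙 (s k <? s l) ≈ 𝟙 ((k ≟ p) ×-dec (l ≟ p′)) - 𝟙 ((k ≟ p′) ×-dec (l ≟ p))
      by-cases (yes (≡.refl , ≡.refl)) _
        rewrite transpose-matchˡ p p′ | transpose-matchʳ p p′
              | 𝟙-yes (p <? p′) (inject₁<suc j) | 𝟙-no (p′ <? p) (<-asym (inject₁<suc j))
              | 𝟙-yes ((p ≟ p) ×-dec (p′ ≟ p′)) (≡.refl , ≡.refl) | 𝟙-no ((p ≟ p′) ×-dec (p′ ≟ p)) (p≢p′ ∘ proj₁) = refl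
      by-cases (no ¬pp′) (yes (≡.refl , ≡.refl))
        rewrite transpose-matchˡ p p′ | transpose-matchʳ p p′
              | 𝟙-yes (p <? p′) (inject₁<suc j) | 𝟙-no (p′ <? p) (<-asym (inject₁<suc j))
              | 𝟙-no ((p′ ≟ p) ×-dec (p ≟ p′)) ¬pp′ | 𝟙-yes ((p′ ≟ p′) ×-dec (p ≟ p)) (≡.refl , ≡.refl) = refl
      by-cases (no ¬pp′) (no ¬p′p)
        rewrite 𝟙-cong (adjacentTransposition-<⇔ j ¬pp′ ¬p′p) (k <? l) (s k <? s l)
              | 𝟙-no ((k ≟ p) ×-dec (l ≟ p′)) ¬pp′ | 𝟙-no ((k ≟ p′) ×-dec (l ≟ p)) ¬p′p
              = trans (-‿inverseʳ _) (sym (-‿inverseʳ 0#))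

    lopObjective-adjacentTransposition : (a : Fin (suc m) → Fin (suc m) → Carrier) (σ : Fin (suc m) → Fin (suc m)) →
      lopObjective R a σ - lopObjective R a (σ ∘ s) ≈ a (σ p) (σ p′) - a (σ p′) (σ p)
    lopObjective-adjacentTransposition a σ = begin
      lopObjective R a σ - lopObjective R a (σ ∘ s)
        ≈⟨ +-cong (lopObjective-𝟙 σ) (-‿cong lop∘s) ⟩
      ∑[ k ∈ L ] ∑[ l ∈ L ] (𝟙 (k <? l) * A k l) - ∑[ k ∈ L ] ∑[ l ∈ L ] (𝟙 (s k <? s l) * A k l)
        ≈⟨ ∑∑-distrib-sub L L _ _ ⟨
      ∑[ k ∈ L ] ∑[ l ∈ L ] (𝟙 (k <? l) * A k l - 𝟙 (s k <? s l) * A k l)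
        ≈⟨ ∑-cong L (λ k → ∑-cong L (λ l → trans (sym ([y-z]x≈yx-zx _ _ _)) (*-congʳ (𝟙-<-adjacentTransposition k l)))) ⟩
      ∑[ k ∈ L ] ∑[ l ∈ L ] ((𝟙 ((k ≟ p) ×-dec (l ≟ p′)) - 𝟙 ((k ≟ p′) ×-dec (l ≟ p))) * A k l)
        ≈⟨ ∑-cong L (λ k → ∑-cong L (λ l → [y-z]x≈yx-zx _ _ _)) ⟩
      ∑[ k ∈ L ] ∑[ l ∈ L ] (𝟙 ((k ≟ p) ×-dec (l ≟ p′)) * A k l - 𝟙 ((k ≟ p′) ×-dec (l ≟ p)) * A k l)
        ≈⟨ ∑∑-distrib-sub L L _ _ ⟩
      ∑[ k ∈ L ] ∑[ l ∈ L ] (𝟙 ((k ≟ p) ×-dec (l ≟ p′)) * A k l) - ∑[ k ∈ L ] ∑[ l ∈ L ] (𝟙 ((k ≟ p′) ×-dec (l ≟ p)) * A k l)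
        ≈⟨ +-cong (∑∑-allFin-sifting p p′ A) (-‿cong (∑∑-allFin-sifting p′ p A)) ⟩
      A p p′ - A p′ p ∎
      where
      L = allFin (suc m)
      A : Fin (suc m) → Fin (suc m) → Carrier
      A k l = a (σ k) (σ l)
      lopObjective-𝟙 : ∀ τ → lopObjective R a τ ≈ ∑[ k ∈ L ] ∑[ l ∈ L ] (𝟙 (k <? l) * a (τ k) (τ l))
      lopObjective-𝟙 τ = ∑-cong L (λ k → ∑-cong L (λ l → select≈𝟙* (k <? l) _))
      lop∘s : lopObjective R a (σ ∘ s) ≈ ∑[ k ∈ L ] ∑[ l ∈ L ] (𝟙 (s k <? s l) * A k l)
      lop∘s = begin
        lopObjective R a (σ ∘ s)
          ≈⟨ lopObjective-𝟙 (σ ∘ s) ⟩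
        ∑[ k ∈ L ] ∑[ l ∈ L ] (𝟙 (k <? l) * A (s k) (s l))
          ≈⟨ ∑-cong L (λ k → ∑-cong L (λ l → reflexive (≡.cong₂ (λ k′ l′ → 𝟙 (k′ <? l′) * A (s k) (s l))
                                                                (≡.sym (s-involutive k)) (≡.sym (s-involutive l))))) ⟩
        ∑[ k ∈ L ] ∑[ l ∈ L ] (𝟙 (s (s k) <? s (s l)) * A (s k) (s l))
          ≈⟨ ∑∑-allFin-transpose p p′ (λ k l → 𝟙 (s k <? s l) * A k l) ⟩
        ∑[ k ∈ L ] ∑[ l ∈ L ] (𝟙 (s k <? s l) * A k l) ∎

  lopObjective-cong : ∀ {n} (a : Fin n → Fin n → Carrier) → lopObjective R a Preserves _≗_ ⟶ _≈_
  lopObjective-cong a σ≗τ = ∑-cong (allFin _) (λ k → ∑-cong (allFin _) (λ l →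
    reflexive (≡.cong₂ (λ u v → if does (k <? l) then a u v else 0#) (σ≗τ k) (σ≗τ l))))

  module _ {n} (q q′ : Fin n) where

    pairCount : Fin n → Fin n → Carrier
    pairCount x y = sumPerm R (λ σ → 𝟙 (σ q ≟ x) * 𝟙 (σ q′ ≟ y))

    pairCounted : Fin n → Fin n → (Fin n → Fin n) → Bool
    pairCounted x y σ = isInjectiveᵇ σ ∧ does ((σ q ≟ x) ×-dec (σ q′ ≟ y))

    pairCounted-true : ∀ {x y σ} → IsInjective σ → σ q ≡ x → σ q′ ≡ y → pairCounted x y σ ≡ true
    pairCounted-true {x} {y} {σ} σ-injective σq≡x σq′≡y
      rewrite isInjectiveᵇ≡does-injective? σ | dec-true (injective? σ) σ-injective
            | dec-true ((σ q ≟ x) ×-dec (σ q′ ≟ y)) (σq≡x , σq′≡y) = ≡.refl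

    pairCount≈length : ∀ x y → pairCount x y ≈ natToR R (length (filterᵇ (pairCounted x y) (allFuns n n)))
    pairCount≈length x y = begin
      pairCount x y
        ≈⟨ ∑-filterᵇ isInjectiveᵇ (allFuns n n) _ ⟩
      ∑[ σ ∈ allFuns n n ] (if isInjectiveᵇ σ then 𝟙 (σ q ≟ x) * 𝟙 (σ q′ ≟ y) else 0#)
        ≈⟨ ∑-cong (allFuns n n) indicator ⟩
      ∑[ σ ∈ allFuns n n ] (if pairCounted x y σ then 1# else 0#)
        ≈⟨ ∑-count (pairCounted x y) (allFuns n n) ⟩
      natToR R (length (filterᵇ (pairCounted x y) (allFuns n n))) ∎
      where
      indicator : ∀ σ → (if isInjectiveᵇ σ then 𝟙 (σ q ≟ x) * 𝟙 (σ q′ ≟ y) else 0#) ≈ (if pairCounted x y σ then 1# else 0#)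
      indicator σ with isInjectiveᵇ σ
      ... | true  = sym (𝟙-* (σ q ≟ x) (σ q′ ≟ y))
      ... | false = refl

    pairCount-positive : q ≢ q′ → ∀ {x y} → x ≢ y → ∃ λ k → pairCount x y ≈ natToR R (suc k)
    pairCount-positive q≢q′ {x} {y} x≢y =
      let w , w-injective , wq≡x , wq′≡y = 2-transitive q≢q′ x≢y
          h , h∈ , h≗w = allFuns-complete n n w
          h-counted = pairCounted-true (IsInjective-≗ (≡.sym ∘ h≗w) w-injective)
                                       (≡.trans (h≗w q) wq≡x) (≡.trans (h≗w q′) wq′≡y)
          k , length≡ = length-filterᵇ-∈ (pairCounted x y) h∈ h-counted
      in k , trans (pairCount≈length x y) (reflexive (≡.cong (natToR R) length≡))

    pairCount-cong : ∀ {x y y′} → y ≢ x → y′ ≢ x → pairCount x y ≈ pairCount x y′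
    pairCount-cong {x} {y} {y′} y≢x y′≢x = begin
      pairCount x y
        ≈⟨ sumPerm-involution (t ∘_) (λ e → ≡.cong t ∘ e) (λ σ → transpose-involutive y y′ ∘ σ)
                              (λ σ σ-inj k l → σ-inj k l ∘ transpose-injective y y′ _ _) g g-cong ⟨
      sumPerm R (λ σ → 𝟙 (t (σ q) ≟ x) * 𝟙 (t (σ q′) ≟ y))
        ≈⟨ ∑-cong (Perms n) (λ σ → reflexive (≡.cong₂ _*_ (𝟙-t (σ q) x tx≡x) (𝟙-t (σ q′) y (transpose-matchˡ y y′)))) ⟩
      pairCount x y′                                       ∎
      where
      t = transpose y y′
      g : (Fin n → Fin n) → Carrier
      g σ = 𝟙 (σ q ≟ x) * 𝟙 (σ q′ ≟ y)
      g-cong : g Preserves _≗_ ⟶ _≈_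
      g-cong σ≗τ = reflexive (≡.cong₂ (λ u v → 𝟙 (u ≟ x) * 𝟙 (v ≟ y)) (σ≗τ q) (σ≗τ q′))
      tx≡x : t x ≡ x
      tx≡x = transpose-mismatch y y′ (y≢x ∘ ≡.sym) (y′≢x ∘ ≡.sym)
      𝟙-t : ∀ u v {v′} → t v ≡ v′ → 𝟙 (t u ≟ v) ≡ 𝟙 (u ≟ v′)
      𝟙-t u v ≡.refl = 𝟙-cong (transpose-≡⇔ y y′) (t u ≟ v) (u ≟ t v)

    ∑-pairCount-* : q ≢ q′ → ∀ x (v : Fin n → Carrier) → v x ≈ 0# →
                    ∃ λ k → ∑[ y ∈ allFin n ] (pairCount x y * v y) ≈ natToR R (suc k) * ∑[ y ∈ allFin n ] v y
    ∑-pairCount-* q≢q′ x v vx≈0 = factor (∃-≢ q≢q′ x)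
      where
      factor : (∃ λ y₀ → y₀ ≢ x) → ∃ λ k → ∑[ y ∈ allFin n ] (pairCount x y * v y) ≈ natToR R (suc k) * ∑[ y ∈ allFin n ] v y
      factor (y₀ , y₀≢x) =
        let k , Kxy₀≈ = pairCount-positive q≢q′ (y₀≢x ∘ ≡.sym)
        in k , (begin
          ∑[ y ∈ allFin n ] (pairCount x y * v y)    ≈⟨ ∑-cong (allFin n) (λ y → to-y₀ y (y ≟ x)) ⟩
          ∑[ y ∈ allFin n ] (pairCount x y₀ * v y)   ≈⟨ *-distribˡ-∑ (allFin n) _ v ⟨
          pairCount x y₀ * ∑[ y ∈ allFin n ] v y     ≈⟨ *-congʳ Kxy₀≈ ⟩
          natToR R (suc k) * ∑[ y ∈ allFin n ] v y   ∎)
        where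
        to-y₀ : ∀ y → Dec (y ≡ x) → pairCount x y * v y ≈ pairCount x y₀ * v y
        to-y₀ y (yes ≡.refl) = trans (*-congˡ vx≈0) (trans (zeroʳ _) (sym (trans (*-congˡ vx≈0) (zeroʳ _))))
        to-y₀ y (no y≢x)     = *-congʳ (pairCount-cong y≢x y₀≢x)

  placementSum : ∀ {n} → ((Fin n → Fin n) → Carrier) → Fin n → Fin n → Carrier
  placementSum f x q = sumPerm R (λ σ → f σ * 𝟙 (σ q ≟ x))

  fourierStd≈placementSum : ∀ {m} (f : (Fin (suc m) → Fin (suc m)) → Carrier) r i →
    fourierStd R f r i ≈ placementSum f (inject₁ r) (inject₁ i) - placementSum f (inject₁ r) (fromℕ m)
  fourierStd≈placementSum {m} f r i =
    trans (∑-cong P (λ σ → x[y-z]≈xy-xz (f σ) _ _))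
          (∑-distrib-sub P (λ σ → f σ * 𝟙 (σ (inject₁ i) ≟ inject₁ r)) (λ σ → f σ * 𝟙 (σ (fromℕ m) ≟ inject₁ r)))
    where P = Perms (suc m)

  module _ {m} (a : Fin (suc m) → Fin (suc m) → Carrier) (j : Fin m) where
    private
      p p′ : Fin (suc m)
      p  = inject₁ j
      p′ = suc j
      s  = adjacentTransposition j
      f  = lopObjective R a
      L  = allFin (suc m)
      P  = Perms (suc m)

    placementSum-adjacent : ∀ x → placementSum f x p - placementSum f x p′ ≈ ∑[ y ∈ L ] (pairCount p p′ x y * (a x y - a y x))
    placementSum-adjacent x = begin
      placementSum f x p - placementSum f x p′
        ≈⟨ +-congˡ (-‿cong placementSum-p′) ⟩
      ∑[ σ ∈ P ] (f σ * 𝟙 (σ p ≟ x)) - ∑[ σ ∈ P ] (f (σ ∘ s) * 𝟙 (σ p ≟ x))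
        ≈⟨ ∑-distrib-sub P _ _ ⟨
      ∑[ σ ∈ P ] (f σ * 𝟙 (σ p ≟ x) - f (σ ∘ s) * 𝟙 (σ p ≟ x))
        ≈⟨ ∑-cong P (λ σ → trans (sym ([y-z]x≈yx-zx _ _ _)) (*-congʳ (lopObjective-adjacentTransposition j a σ))) ⟩
      ∑[ σ ∈ P ] ((a (σ p) (σ p′) - a (σ p′) (σ p)) * 𝟙 (σ p ≟ x))
        ≈⟨ ∑-cong P (λ σ → localise (σ p) (σ p′) (σ p ≟ x)) ⟩
      ∑[ σ ∈ P ] (𝟙 (σ p ≟ x) * (a x (σ p′) - a (σ p′) x))
        ≈⟨ ∑-cong P (λ σ → *-congˡ (sift-p′ σ)) ⟨
      ∑[ σ ∈ P ] (𝟙 (σ p ≟ x) * ∑[ y ∈ L ] (𝟙 (σ p′ ≟ y) * (a x y - a y x)))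
        ≈⟨ ∑-cong P (λ σ → trans (*-distribˡ-∑ L _ _) (∑-cong L (λ y → sym (*-assoc _ _ _)))) ⟩
      ∑[ σ ∈ P ] ∑[ y ∈ L ] (𝟙 (σ p ≟ x) * 𝟙 (σ p′ ≟ y) * (a x y - a y x))
        ≈⟨ ∑-comm P L _ ⟩
      ∑[ y ∈ L ] ∑[ σ ∈ P ] (𝟙 (σ p ≟ x) * 𝟙 (σ p′ ≟ y) * (a x y - a y x))
        ≈⟨ ∑-cong L (λ y → *-distribʳ-∑ P _ _) ⟨
      ∑[ y ∈ L ] (pairCount p p′ x y * (a x y - a y x)) ∎
      where
      placementSum-p′ : placementSum f x p′ ≈ ∑[ σ ∈ P ] (f (σ ∘ s) * 𝟙 (σ p ≟ x))
      placementSum-p′ = trans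
        (sym (sumPerm-involution (_∘ s) (λ σ≗τ → σ≗τ ∘ s) (λ σ → ≡.cong σ ∘ transpose-involutive p p′)
                                 (λ σ σ-inj k l → transpose-injective p p′ k l ∘ σ-inj _ _)
                                 (λ σ → f σ * 𝟙 (σ p′ ≟ x))
                                 (λ σ≗τ → *-cong (lopObjective-cong a σ≗τ) (reflexive (≡.cong (λ u → 𝟙 (u ≟ x)) (σ≗τ p′))))))
        (∑-cong P (λ σ → reflexive (≡.cong (λ u → f (σ ∘ s) * 𝟙 (σ u ≟ x)) (transpose-matchʳ p p′))))
      localise : ∀ u v → Dec (u ≡ x) → (a u v - a v u) * 𝟙 (u ≟ x) ≈ 𝟙 (u ≟ x) * (a x v - a v x)
      localise u v (yes ≡.refl) = *-comm _ _
      localise u v (no u≢x) rewrite 𝟙-no (u ≟ x) u≢x = trans (zeroʳ _) (sym (zeroˡ _))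
      sift-p′ : ∀ σ → ∑[ y ∈ L ] (𝟙 (σ p′ ≟ y) * (a x y - a y x)) ≈ a x (σ p′) - a (σ p′) x
      sift-p′ σ = trans (∑-cong L (λ y → *-congʳ (reflexive (𝟙-cong (mk⇔ ≡.sym ≡.sym) (σ p′ ≟ y) (y ≟ σ p′)))))
                        (allFin-sifting (σ p′) (λ y → a x y - a y x) (reflexive ∘ ≡.cong (λ y → a x y - a y x)))

    placementSum-adjacent-∝ : ∀ x → ∃ λ k → placementSum f x p - placementSum f x p′ ≈ natToR R (suc k) * ∑[ y ∈ L ] (a x y - a y x)
    placementSum-adjacent-∝ x =
      let k , weighted≈ = ∑-pairCount-* p p′ (<⇒≢ (inject₁<suc j)) x (λ y → a x y - a y x) (-‿inverseʳ _)
      in k , trans (placementSum-adjacent x) weighted≈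

  natToR-suc-cancel : IsCharZeroField R → ∀ k {x} → natToR R (suc k) * x ≈ 0# → x ≈ 0#
  natToR-suc-cancel F k {x} kx≈0 = begin
    x                             ≈⟨ *-identityˡ x ⟨
    1# * x                        ≈⟨ *-congʳ (trans (sym k*k⁻¹≈1) (*-comm _ _)) ⟩
    k⁻¹ * natToR R (suc k) * x    ≈⟨ *-assoc _ _ _ ⟩
    k⁻¹ * (natToR R (suc k) * x)  ≈⟨ *-congˡ kx≈0 ⟩
    k⁻¹ * 0#                      ≈⟨ zeroʳ k⁻¹ ⟩
    0#                            ∎
    where
    open IsCharZeroField F
    k⁻¹ = proj₁ (inverse (natToR R (suc k)) (charZero k))
    k*k⁻¹≈1 = proj₂ (inverse (natToR R (suc k)) (charZero k))

  module _ {m} (a : Fin (suc m) → Fin (suc m) → Carrier) where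
    private
      f = lopObjective R a

    balanced⇒fourierStd-zero : (∀ x → sumFin R (λ y → a x y - a y x) ≈ 0#) → IsZeroMatrix R (fourierStd R f)
    balanced⇒fourierStd-zero balanced r i = begin
      fourierStd R f r i                                          ≈⟨ fourierStd≈placementSum f r i ⟩
      placementSum f x (inject₁ i) - placementSum f x (fromℕ m)   ≈⟨ +-congʳ (adjacent≈⇒≈fromℕ (placementSum f x) adjacent (inject₁ i)) ⟩
      placementSum f x (fromℕ m) - placementSum f x (fromℕ m)     ≈⟨ -‿inverseʳ _ ⟩
      0#                                                          ∎
      where
      x = inject₁ r
      adjacent : ∀ j → placementSum f x (inject₁ j) ≈ placementSum f x (suc j)
      adjacent j = let k , difference≈ = placementSum-adjacent-∝ a j x
                   in x∙y⁻¹≈ε⇒x≈y _ _ (trans difference≈ (trans (*-congˡ (balanced x)) (zeroʳ _)))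

  fourierStd-zero⇒balanced : IsCharZeroField R → ∀ {m} (a : Fin (suc (suc m)) → Fin (suc (suc m)) → Carrier) →
                             IsZeroMatrix R (fourierStd R (lopObjective R a)) → ∀ x → sumFin R (λ y → a x y - a y x) ≈ 0#
  fourierStd-zero⇒balanced F {m} a fourier≈0 = balanced
    where
    f = lopObjective R a
    imbalance : Fin (suc (suc m)) → Carrier
    imbalance x = sumFin R (λ y → a x y - a y x)
    balanced-inject₁ : ∀ r → imbalance (inject₁ r) ≈ 0#
    balanced-inject₁ r =
      let k , difference≈ = placementSum-adjacent-∝ a (fromℕ m) (inject₁ r)
      in natToR-suc-cancel F k (begin
        natToR R (suc k) * imbalance (inject₁ r)
          ≈⟨ difference≈ ⟨
        placementSum f (inject₁ r) (inject₁ (fromℕ m)) - placementSum f (inject₁ r) (fromℕ (suc m))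
          ≈⟨ fourierStd≈placementSum f r (fromℕ m) ⟨
        fourierStd R f r (fromℕ m)
          ≈⟨ fourier≈0 r (fromℕ m) ⟩
        0# ∎)
    balanced-other : ∀ x → x ≢ fromℕ (suc m) → imbalance x ≈ 0#
    balanced-other x x≢last with view x
    ... | ‵fromℕ     = ⊥-elim (x≢last ≡.refl)
    ... | ‵inject₁ r = balanced-inject₁ r
    balanced-last : imbalance (fromℕ (suc m)) ≈ 0#
    balanced-last = trans (sym (∑-concentrated (≡-decSetoid _) {allFin _} allFin-sifting (fromℕ (suc m)) imbalance
                                              (reflexive ∘ ≡.cong imbalance) balanced-other))
                          (∑∑-antisymmetric (allFin _) a)
    balanced : ∀ x → imbalance x ≈ 0#
    balanced x with view x
    ... | ‵fromℕ     = balanced-last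
    ... | ‵inject₁ r = balanced-inject₁ r

proposition3 : ∀ {c ℓ} (R : CommutativeRing c ℓ) → IsCharZeroField R →
    (m : ℕ) → 2 ≤ suc m →
    (a : Fin (suc m) → Fin (suc m) → CommutativeRing.Carrier R) →
    (∀ i → CommutativeRing._≈_ R (a i i) (CommutativeRing.0# R)) →
    (IsZeroMatrix R (fourierStd R (lopObjective R a))
      ⇔ (∀ i → CommutativeRing._≈_ R
               (sumFin R (λ j → CommutativeRing._-_ R (a i j) (a j i)))
               (CommutativeRing.0# R)))
proposition3 R F zero    (s≤s ()) a _
proposition3 R F (suc m) _          a _ =
  mk⇔ (LinearOrdering.fourierStd-zero⇒balanced R F a) (LinearOrdering.balanced⇒fourierStd-zero R a)
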